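{- Let $G$ be a graph on $n$ vertices with maximum degree $\Delta(G)=n-1$ that contains none of $C_5$, $K_4$, $K_2\oplus E_3$ as a subgraph. Then $G$ is locatable.
   Context: $K_2\oplus E_3$ denotes the graph formed by an edge $xy$ together with three pairwise non-adjacent vertices each adjacent to both $x$ and $y$. Subgraphs are not required to be induced. The robber-locating game on a finite connected simple graph $G$: a robber occupies an unknown vertex. In each round the cop probes any vertex $p$ of $G$ (no restriction), and the robber truthfully announces the graph distance from his current vertex to $p$. If the information gathered so far determines the robber's current vertex uniquely, the cop wins. Otherwise the robber moves to an adjacent vertex or stays put, with the no-backtrack condition: he may not move to the vertex $p$ just probed. The robber is omniscient. $G$ is locatable if the cop has a strategy guaranteed to determine the robber's vertex after finitely many probes, and non-locatable otherwise. -}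

module Defs where

open import Data.Nat using (ℕ; zero; suc; _<_; _⊔_; _∸_; _≡ᵇ_; _<ᵇ_)
open import Data.Fin using (Fin; toℕ; _≟_)
open import Data.Bool using (Bool; true; false; if_then_else_; not; _∧_; _∨_)
open import Data.List using (List; map; foldr; allFin)
open import Data.Nat.ListAction using (sum)
open import Data.Product using (Σ; _×_; ∃; _,_)
open import Data.Sum using (_⊎_)
open import Data.Unit using (⊤)
open import Relation.Nullary using (¬_)
open import Relation.Nullary.Decidable using (isYes)
open import Relation.Binary.PropositionalEquality using (_≡_; _≢_)
open import Function.Definitions using (Injective)

record Graph (n : ℕ) : Set where
  field
    adj   : Fin n → Fin n → Bool
    sym   : ∀ u v → adj u v ≡ adj v u
    loopless : ∀ v → adj v v ≡ false
open Graph public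

module _ {n : ℕ} (G : Graph n) where

  Adj : Fin n → Fin n → Set
  Adj u v = adj G u v ≡ true

  degree : Fin n → ℕ
  degree u = sum (map (λ v → if adj G u v then 1 else 0) (allFin n))

  maxDegree : ℕ
  maxDegree = foldr _⊔_ 0 (map degree (allFin n))

  data Walk : Fin n → Fin n → ℕ → Set where
    here : ∀ {u} → Walk u u 0
    step : ∀ {u v w k} → Adj u v → Walk v w k → Walk u w (suc k)

  Dist : Fin n → Fin n → ℕ → Set
  Dist u v d = Walk u v d × (∀ m → m < d → ¬ Walk u v m)

  ContainsSubgraph : {k : ℕ} → (Fin k → Fin k → Bool) → Set
  ContainsSubgraph {k} h =
    Σ (Fin k → Fin n) λ f → Injective _≡_ _≡_ f ×
      (∀ a b → h a b ≡ true → Adj (f a) (f b))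

  -- The robber-locating game, via the cop's knowledge set
  -- S : Fin n → Set = set of robber positions consistent with all
  -- answers so far.

  Answer : (Fin n → Set) → Fin n → ℕ → (Fin n → Set)
  Answer S p d v = S v × Dist v p d

  Move : Fin n → (Fin n → Set) → (Fin n → Set)
  Move p S w = w ≢ p × ∃ λ v → S v × (w ≡ v ⊎ Adj v w)

  Determined : (Fin n → Set) → Set
  Determined S = ∀ u v → S u → S v → u ≡ v

  -- The cop wins from knowledge set S in finitely many probes.
  -- (Answers leaving no consistent position are vacuously Determined.)
  data CopWins : (Fin n → Set) → Set₁ where
    probe : ∀ {S} (p : Fin n) →
            (∀ d → Determined (Answer S p d) ⊎ CopWins (Move p (Answer S p d))) →
            CopWins S

  Locatable : Set₁
  Locatable = CopWins (λ _ → ⊤)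

-- C₅ : edges i ~ i+1 (mod 5)
adjC5 : Fin 5 → Fin 5 → Bool
adjC5 i j = nbr (toℕ i) (toℕ j) ∨ nbr (toℕ j) (toℕ i)
  where
  nbr : ℕ → ℕ → Bool
  nbr a b = (suc a ≡ᵇ b) ∨ ((a ≡ᵇ 4) ∧ (b ≡ᵇ 0))

adjK4 : Fin 4 → Fin 4 → Bool
adjK4 i j = not (isYes (i ≟ j))

-- K₂ ⊕ E₃ : vertices 0 = x, 1 = y adjacent; 2,3,4 pairwise non-adjacent,
-- each adjacent to both x and y.
adjK2E3 : Fin 5 → Fin 5 → Bool
adjK2E3 i j = not (isYes (i ≟ j)) ∧ ((toℕ i <ᵇ 2) ∨ (toℕ j <ᵇ 2))

module Submission where

-- A vertex of degree n - 1 is universal; call it u.  Adding u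
-- to a triangle, to a path on four vertices, or to a vertex with three
-- neighbours of G - u would produce K₄, C₅ or K₂ ⊕ E₃ respectively, so
-- G - u is triangle-free, P₄-free and of maximum degree at most 2: every
-- component of G - u is a star with at most two leaves, whose centre
-- ("hub") sees every vertex it can reach in two steps.
--
-- The cop keeps the robber inside a region T (a union of
-- components of G - u).  Probing the hub p of one component of T either
-- locates the robber (answer 0), traps him in the star of p or at u
-- (answer 1; one more probe at a leaf finishes), or shows he is outside
-- that star (answer 2); in the last case a probe at u either catches him
-- or confines him to the strictly smaller region T minus the star.
-- Well-founded induction on ⊂ for regions ends the game.

open import Defs
open import Data.Nat using (ℕ; zero; suc; _≤_; _<_; _∸_; s≤s; z≤n)
open import Data.Nat.Properties using (⊔-sel; ≤-trans; ≤-reflexive; ≤-pred; 1+n≰n; module ≤-Reasoning)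
open import Data.Fin as Fin using (Fin; _<?_; _≟_)
open import Data.Fin.Properties using (<-cmp; all?; any?)
open import Data.Fin.Subset using (Subset; _∈_; _∉_; _⊆_; _⊂_; _∪_; _∩_; ∁; ⁅_⁆; _-_; ∣_∣; ⊤)
open import Data.Fin.Subset.Properties
  using (∈⊤; x∈⁅x⁆; x∈⁅y⁆⇒x≡y; x≢y⇒x∉⁅y⁆; x∈p∪q⁻; x∈p∪q⁺; x∈p∩q⁺; x∈p∩q⁻; p∩q⊆p; x∈p⇒x∉∁p; x∈∁p⇒x∉p;
         x∉p⇒x∈∁p; nonempty?; x∈p∧x≢y⇒x∈p-y; x∈p⇒∣p-x∣<∣p∣; p⊆q⇒∣p∣≤∣q∣; ∣⊤∣≡n)
open import Data.Fin.Subset.Induction using (⊂-wellFounded; Acc; acc)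
open import Data.Bool using (Bool; true; false; if_then_else_)
open import Data.Bool.Properties using () renaming (_≟_ to _≟ᵇ_)
open import Data.List using (List; filter; cartesianProduct; allFin; map)
import Data.List as List
open import Data.List.Properties using (map-tabulate)
open import Data.List.Relation.Unary.All as All using (All; []; _∷_)
open import Data.List.Membership.Propositional using () renaming (_∈_ to _∈ₗ_)
open import Data.List.Membership.Propositional.Properties
  using (∈-filter⁺; ∈-cartesianProduct⁺; ∈-allFin; foldr-selective; ∈-map⁻)
open import Data.Nat.ListAction using (sum)
open import Data.Vec using (Vec; lookup; tabulate; []; _∷_)
open import Data.Vec.Properties using (lookup∘tabulate; []=⇒lookup; lookup⇒[]=)
open import Data.Product using (∃; _×_; _,_; proj₁; proj₂)
open import Data.Sum using (_⊎_; inj₁; inj₂)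
open import Data.Empty using (⊥; ⊥-elim)
open import Relation.Nullary using (¬_; Dec; yes; no)
open import Relation.Nullary.Decidable using (_×-dec_; ¬?; from-yes)
open import Relation.Binary.Definitions using (tri<; tri≈; tri>)
open import Relation.Binary.PropositionalEquality
  using (_≡_; _≢_; refl; trans; cong; ≢-sym) renaming (sym to ≡-sym)

module _ {n : ℕ} (G : Graph n) where

  Adj-sym : ∀ {a b} → Adj G a b → Adj G b a
  Adj-sym {a} {b} a~b = trans (Graph.sym G b a) a~b

  Adj⇒≢ : ∀ {a b} → Adj G a b → a ≢ b
  Adj⇒≢ {a} a~a refl with trans (≡-sym (loopless G a)) a~a
  ... | ()

  neighbourhood : Fin n → Subset n
  neighbourhood v = tabulate (adj G v)

  ∈-neighbourhood⁺ : ∀ {v w} → Adj G v w → w ∈ neighbourhood v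
  ∈-neighbourhood⁺ {v} {w} v~w = lookup⇒[]= w (neighbourhood v) (trans (lookup∘tabulate (adj G v) w) v~w)

  ∈-neighbourhood⁻ : ∀ {v w} → w ∈ neighbourhood v → Adj G v w
  ∈-neighbourhood⁻ {v} {w} w∈N = trans (≡-sym (lookup∘tabulate (adj G v) w)) ([]=⇒lookup w∈N)

  dist0⇒≡ : ∀ {v x} → Dist G v x 0 → v ≡ x
  dist0⇒≡ (here , _) = refl

  dist1⇒Adj : ∀ {v x} → Dist G v x 1 → Adj G v x
  dist1⇒Adj (step v~x here , _) = v~x

  dist2⇒¬Adj : ∀ {v x} → Dist G v x 2 → ¬ Adj G v x
  dist2⇒¬Adj (_ , shortest) v~x = shortest 1 (s≤s (s≤s z≤n)) (step v~x here)

  dist2⇒≢ : ∀ {v x} → Dist G v x 2 → v ≢ x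
  dist2⇒≢ (_ , shortest) refl = shortest 0 (s≤s z≤n) here

  at-most-one-wins : ∀ {S : Fin n → Set} (c : Fin n) → (∀ v → S v → v ≡ c) → CopWins G S
  at-most-one-wins {S} c only-c = probe c λ _ → inj₁ λ a b Sa Sb →
    trans (only-c a (proj₁ Sa)) (≡-sym (only-c b (proj₁ Sb)))

  answer0-determined : ∀ (S : Fin n → Set) p → Determined G (Answer G S p 0)
  answer0-determined S p a b (_ , a≡p) (_ , b≡p) = trans (dist0⇒≡ a≡p) (≡-sym (dist0⇒≡ b≡p))

degree≡∣neighbourhood∣ : ∀ {n} (G : Graph n) v → degree G v ≡ ∣ neighbourhood G v ∣
degree≡∣neighbourhood∣ {n} G v =
  trans (cong sum (map-tabulate (λ w → w) indicator)) (sum-indicators (adj G v))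
  where
  indicator : Fin n → ℕ
  indicator w = if adj G v w then 1 else 0

  sum-indicators : ∀ {k} (f : Fin k → Bool) →
                   sum (List.tabulate (λ w → if f w then 1 else 0)) ≡ ∣ tabulate f ∣
  sum-indicators {zero} f = refl
  sum-indicators {suc k} f with f Fin.zero
  ... | true  = cong suc (sum-indicators (λ w → f (Fin.suc w)))
  ... | false = sum-indicators (λ w → f (Fin.suc w))

-- In a graph on m + 1 vertices, a vertex of degree ≥ m is adjacent to all
-- others: a missing neighbour v ≠ u would squeeze the neighbourhood of u
-- into the m - 1 vertices other than u and v.
dominating : ∀ {m} (G : Graph (suc m)) u → m ≤ degree G u → ∀ v → v ≢ u → Adj G u v
dominating {m} G u m≤deg v v≢u with adj G u v in u≁v
... | true  = refl
... | false = ⊥-elim (1+n≰n (≤-trans (≤-pred two-missing) m≤∣N∣))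
  where
  open ≤-Reasoning
  N : Subset (suc m)
  N = neighbourhood G u

  m≤∣N∣ : m ≤ ∣ N ∣
  m≤∣N∣ = ≤-trans m≤deg (≤-reflexive (degree≡∣neighbourhood∣ G u))

  N⊆rest : N ⊆ ⊤ - u - v
  N⊆rest {w} w∈N = x∈p∧x≢y⇒x∈p-y (x∈p∧x≢y⇒x∈p-y ∈⊤ (≢-sym (Adj⇒≢ G u~w))) w≢v
    where
    u~w : Adj G u w
    u~w = ∈-neighbourhood⁻ G w∈N
    w≢v : w ≢ v
    w≢v refl with trans (≡-sym u≁v) u~w
    ... | ()

  two-missing : suc (suc ∣ N ∣) ≤ suc m
  two-missing = begin
    suc (suc ∣ N ∣)         ≤⟨ s≤s (s≤s (p⊆q⇒∣p∣≤∣q∣ N⊆rest)) ⟩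
    suc (suc ∣ ⊤ - u - v ∣) ≤⟨ s≤s (x∈p⇒∣p-x∣<∣p∣ (x∈p∧x≢y⇒x∈p-y ∈⊤ v≢u)) ⟩
    suc ∣ ⊤ - u ∣           ≤⟨ x∈p⇒∣p-x∣<∣p∣ (∈⊤ {x = u}) ⟩
    ∣ ⊤ {suc m} ∣           ≡⟨ ∣⊤∣≡n (suc m) ⟩
    suc m                   ∎

maxDegree-attained : ∀ {n} (G : Graph n) → maxDegree G ≡ 0 ⊎ ∃ λ v → maxDegree G ≡ degree G v
maxDegree-attained G with foldr-selective ⊔-sel 0 (map (degree G) (allFin _))
... | inj₁ max≡0 = inj₁ max≡0
... | inj₂ max∈degrees with ∈-map⁻ (degree G) max∈degrees
...   | v , _ , max≡deg = inj₂ (v , max≡deg)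

full-degree-vertex : ∀ {m} (G : Graph (suc m)) → maxDegree G ≡ m → ∃ λ u → m ≤ degree G u
full-degree-vertex G Δ≡m with maxDegree-attained G
... | inj₁ Δ≡0           = Fin.zero , ≤-trans (≤-reflexive (trans (≡-sym Δ≡m) Δ≡0)) z≤n
... | inj₂ (v , Δ≡deg-v) = v , ≤-reflexive (trans (≡-sym Δ≡m) Δ≡deg-v)

-- A pattern is a simple graph on Fin k given by a Boolean
-- adjacency function; to exhibit it in G one lists k vertices of G, checks
-- the pattern's edges, and checks distinctness of its non-adjacent pairs
-- (adjacent pairs are distinct automatically).
IsSimple : ∀ {k} → (Fin k → Fin k → Bool) → Set
IsSimple h = (∀ a → h a a ≡ false) × (∀ a b → h a b ≡ h b a)

isSimple? : ∀ {k} (h : Fin k → Fin k → Bool) → Dec (IsSimple h)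
isSimple? h = all? (λ a → h a a ≟ᵇ false) ×-dec all? (λ a → all? (λ b → h a b ≟ᵇ h b a))

increasingPairs : (k : ℕ) → List (Fin k × Fin k)
increasingPairs k = filter (λ (a , b) → a <? b) (cartesianProduct (allFin k) (allFin k))

edgesOf : ∀ {k} → (Fin k → Fin k → Bool) → List (Fin k × Fin k)
edgesOf h = filter (λ (a , b) → h a b ≟ᵇ true) (increasingPairs _)

nonEdgesOf : ∀ {k} → (Fin k → Fin k → Bool) → List (Fin k × Fin k)
nonEdgesOf h = filter (λ (a , b) → h a b ≟ᵇ false) (increasingPairs _)

∈-increasingPairs : ∀ {k} {a b : Fin k} → a Fin.< b → (a , b) ∈ₗ increasingPairs k
∈-increasingPairs {a = a} {b} a<b =
  ∈-filter⁺ (λ (a , b) → a <? b) (∈-cartesianProduct⁺ (∈-allFin a) (∈-allFin b)) a<b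

module _ {n : ℕ} (G : Graph n) where

  embed : ∀ {k} (h : Fin k → Fin k → Bool) → IsSimple h → (xs : Vec (Fin n) k) →
          All (λ (a , b) → Adj G (lookup xs a) (lookup xs b)) (edgesOf h) →
          All (λ (a , b) → lookup xs a ≢ lookup xs b) (nonEdgesOf h) →
          ContainsSubgraph G h
  embed {k} h (irreflexive , symmetric) xs edges nonEdges = f , injective , preserves
    where
    f : Fin k → Fin n
    f = lookup xs

    edge : ∀ {a b} → a Fin.< b → h a b ≡ true → Adj G (f a) (f b)
    edge {a} {b} a<b hab = All.lookup edges
      (∈-filter⁺ (λ (a , b) → h a b ≟ᵇ true) (∈-increasingPairs a<b) hab)

    separated : ∀ {a b} → a Fin.< b → f a ≢ f b
    separated {a} {b} a<b with h a b in hab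
    ... | true  = Adj⇒≢ G (edge a<b hab)
    ... | false = All.lookup nonEdges
      (∈-filter⁺ (λ (a , b) → h a b ≟ᵇ false) (∈-increasingPairs a<b) hab)

    injective : ∀ {a b} → f a ≡ f b → a ≡ b
    injective {a} {b} fa≡fb with <-cmp a b
    ... | tri< a<b _ _ = ⊥-elim (separated a<b fa≡fb)
    ... | tri≈ _ a≡b _ = a≡b
    ... | tri> _ _ b<a = ⊥-elim (separated b<a (≡-sym fa≡fb))

    preserves : ∀ a b → h a b ≡ true → Adj G (f a) (f b)
    preserves a b hab with <-cmp a b
    ... | tri< a<b _ _ = edge a<b hab
    ... | tri≈ _ refl _ with trans (≡-sym (irreflexive a)) hab
    ...   | ()
    preserves a b hab | tri> _ _ b<a = Adj-sym G (edge b<a (trans (symmetric b a) hab))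

module _ {n : ℕ} (G : Graph n) (u : Fin n) where

  TriangleFree : Set
  TriangleFree = ∀ {a b c} → a ≢ u → b ≢ u → c ≢ u →
                 Adj G a b → Adj G b c → Adj G a c → ⊥

  P₄Free : Set
  P₄Free = ∀ {a b c d} → a ≢ u → b ≢ u → c ≢ u → d ≢ u → a ≢ c → a ≢ d → b ≢ d →
           Adj G a b → Adj G b c → Adj G c d → ⊥

  ClawFree : Set
  ClawFree = ∀ {p a b c} → p ≢ u → a ≢ u → b ≢ u → c ≢ u → a ≢ b → a ≢ c → b ≢ c →
             Adj G p a → Adj G p b → Adj G p c → ⊥

  module _ (universal : ∀ v → v ≢ u → Adj G u v) where

    noK₄⇒triangleFree : ¬ ContainsSubgraph G adjK4 → TriangleFree
    noK₄⇒triangleFree noK₄ {a} {b} {c} a≢u b≢u c≢u a~b b~c a~c =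
      noK₄ (embed G adjK4 (from-yes (isSimple? adjK4)) (u ∷ a ∷ b ∷ c ∷ [])
        (universal a a≢u ∷ universal b b≢u ∷ universal c c≢u ∷ a~b ∷ a~c ∷ b~c ∷ [])
        [])

    noC₅⇒P₄Free : ¬ ContainsSubgraph G adjC5 → P₄Free
    noC₅⇒P₄Free noC₅ {a} {b} {c} {d} a≢u b≢u c≢u d≢u a≢c a≢d b≢d a~b b~c c~d =
      noC₅ (embed G adjC5 (from-yes (isSimple? adjC5)) (u ∷ a ∷ b ∷ c ∷ d ∷ [])
        (universal a a≢u ∷ universal d d≢u ∷ a~b ∷ b~c ∷ c~d ∷ [])
        (≢-sym b≢u ∷ ≢-sym c≢u ∷ a≢c ∷ a≢d ∷ b≢d ∷ []))

    noK₂⊕E₃⇒clawFree : ¬ ContainsSubgraph G adjK2E3 → ClawFree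
    noK₂⊕E₃⇒clawFree noK₂⊕E₃ {p} {a} {b} {c} p≢u a≢u b≢u c≢u a≢b a≢c b≢c p~a p~b p~c =
      noK₂⊕E₃ (embed G adjK2E3 (from-yes (isSimple? adjK2E3)) (u ∷ p ∷ a ∷ b ∷ c ∷ [])
        (universal p p≢u ∷ universal a a≢u ∷ universal b b≢u ∷ universal c c≢u ∷
         p~a ∷ p~b ∷ p~c ∷ [])
        (a≢b ∷ a≢c ∷ b≢c ∷ []))

module StarStrategy {n : ℕ} (G : Graph n) (u : Fin n)
  (universal : ∀ v → v ≢ u → Adj G u v)
  (triangleFree : TriangleFree G u) (p₄Free : P₄Free G u) (clawFree : ClawFree G u) where

  -- Every vertex is adjacent to u, so G has diameter at most 2 ...
  walk<3 : ∀ v x → ∃ λ k → k < 3 × Walk G v x k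
  walk<3 v x with v ≟ x | v ≟ u | x ≟ u
  ... | yes refl | _        | _        = 0 , s≤s z≤n , here
  ... | no v≢x   | yes refl | _        = 1 , s≤s (s≤s z≤n) , step (universal x (≢-sym v≢x)) here
  ... | no _     | no v≢u   | yes refl = 1 , s≤s (s≤s z≤n) , step (Adj-sym G (universal v v≢u)) here
  ... | no _     | no v≢u   | no x≢u   =
    2 , s≤s (s≤s (s≤s z≤n)) , step (Adj-sym G (universal v v≢u)) (step (universal x x≢u) here)

  no-dist≥3 : ∀ {v x d} → ¬ Dist G v x (suc (suc (suc d)))
  no-dist≥3 {v} {x} (_ , shortest) with walk<3 v x
  ... | k , k<3 , walk = shortest k (≤-trans k<3 (s≤s (s≤s (s≤s z≤n)))) walk

  no-dist-to-u≥2 : ∀ {v d} → ¬ Dist G v u (suc (suc d))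
  no-dist-to-u≥2 {v} (_ , shortest) with v ≟ u
  ... | yes refl = shortest 0 (s≤s z≤n) here
  ... | no v≢u   = shortest 1 (s≤s (s≤s z≤n)) (step (Adj-sym G (universal v v≢u)) here)

  -- A region is a set of vertices of G - u closed under adjacency in G - u,
  -- i.e. a union of components of G - u.  A robber in a region stays in it
  -- unless he moves to u.
  record Region (T : Subset n) : Set where
    field
      avoids-u : u ∉ T
      closed   : ∀ {v w} → v ∈ T → Adj G v w → w ≢ u → w ∈ T

    ∈⇒≢u : ∀ {v} → v ∈ T → v ≢ u
    ∈⇒≢u v∈T refl = avoids-u v∈T

    stays : ∀ {v w} → v ∈ T → w ≡ v ⊎ Adj G v w → w ≢ u → w ∈ T
    stays v∈T (inj₁ refl) _   = v∈T
    stays v∈T (inj₂ v~w)  w≢u = closed v∈T v~w w≢u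

  open Region

  Confined : Subset n → Set₁
  Confined T = ∀ (S : Fin n → Set) → (∀ v → S v → v ∈ T) → CopWins G S

  Hub : Fin n → Set
  Hub p = ∀ {y x} → Adj G p y → y ≢ u → Adj G y x → x ≢ u → x ≡ p

  -- The middle vertex a of a path q a b in G - u is a hub: a two-step walk
  -- from a to any other vertex would close a triangle or a P₄.
  middle-is-hub : ∀ {q a b} → q ≢ u → a ≢ u → b ≢ u → b ≢ q → Adj G q a → Adj G a b → Hub a
  middle-is-hub {q} {a} {b} q≢u a≢u b≢u b≢q q~a a~b {y} {x} a~y y≢u y~x x≢u with x ≟ a
  ... | yes x≡a = x≡a
  ... | no x≢a with y ≟ q
  ...   | yes refl with x ≟ b
  ...     | yes refl = ⊥-elim (triangleFree a≢u y≢u x≢u a~y y~x a~b)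
  ...     | no x≢b   = ⊥-elim (p₄Free x≢u y≢u a≢u b≢u x≢a x≢b (≢-sym b≢q)
                                  (Adj-sym G y~x) (Adj-sym G a~y) a~b)
  middle-is-hub {q} {a} {b} q≢u a≢u b≢u b≢q q~a a~b {y} {x} a~y y≢u y~x x≢u
    | no x≢a | no y≢q with x ≟ q
  ...   | yes refl = ⊥-elim (triangleFree a≢u y≢u x≢u a~y y~x (Adj-sym G q~a))
  ...   | no x≢q   = ⊥-elim (p₄Free x≢u y≢u a≢u q≢u x≢a x≢q y≢q
                               (Adj-sym G y~x) (Adj-sym G a~y) (Adj-sym G q~a))

  -- Every nonempty region contains a hub: the middle of a path q a b if q
  -- starts one, and q itself otherwise.
  hub-exists : ∀ {T} → Region T → ∀ {q} → q ∈ T → ∃ λ p → p ∈ T × Hub p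
  hub-exists R {q} q∈T with any? (λ a → ((adj G q a ≟ᵇ true) ×-dec ¬? (a ≟ u)) ×-dec
                          any? (λ b → (adj G a b ≟ᵇ true) ×-dec ¬? (b ≟ u) ×-dec ¬? (b ≟ q)))
  ... | yes (a , (q~a , a≢u) , b , a~b , b≢u , b≢q) =
    a , closed R q∈T q~a a≢u , middle-is-hub (∈⇒≢u R q∈T) a≢u b≢u b≢q q~a a~b
  ... | no no-path = q , q∈T , q-hub
    where
    q-hub : Hub q
    q-hub {y} {x} q~y y≢u y~x x≢u with x ≟ q
    ... | yes x≡q = x≡q
    ... | no x≢q  = ⊥-elim (no-path (y , (q~y , y≢u) , x , y~x , x≢u , x≢q))

  star : Fin n → Subset n
  star p = ⁅ p ⁆ ∪ neighbourhood G p

  beyond : Subset n → Fin n → Subset n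
  beyond T p = T ∩ ∁ (star p)

  ∈-beyond⁺ : ∀ {T p v} → v ∈ T → v ≢ p → ¬ Adj G p v → v ∈ beyond T p
  ∈-beyond⁺ {T} {p} {v} v∈T v≢p p≁v = x∈p∩q⁺ (v∈T , x∉p⇒x∈∁p v∉star)
    where
    v∉star : v ∉ star p
    v∉star v∈star with x∈p∪q⁻ ⁅ p ⁆ (neighbourhood G p) v∈star
    ... | inj₁ v∈⁅p⁆ = v≢p (x∈⁅y⁆⇒x≡y p v∈⁅p⁆)
    ... | inj₂ v∈N   = p≁v (∈-neighbourhood⁻ G v∈N)

  ∈-beyond⁻ : ∀ {T p v} → v ∈ beyond T p → v ∈ T × v ≢ p × ¬ Adj G p v
  ∈-beyond⁻ {T} {p} {v} v∈beyond = v∈T , v≢p , p≁v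
    where
    v∈T : v ∈ T
    v∈T = proj₁ (x∈p∩q⁻ T _ v∈beyond)
    v∉star : v ∉ star p
    v∉star = x∈∁p⇒x∉p (proj₂ (x∈p∩q⁻ T _ v∈beyond))
    v≢p : v ≢ p
    v≢p refl = v∉star (x∈p∪q⁺ (inj₁ (x∈⁅x⁆ p)))
    p≁v : ¬ Adj G p v
    p≁v p~v = v∉star (x∈p∪q⁺ (inj₂ (∈-neighbourhood⁺ G p~v)))

  beyond-⊂ : ∀ {T p} → p ∈ T → beyond T p ⊂ T
  beyond-⊂ {T} {p} p∈T = p∩q⊆p T _ , p , p∈T , λ p∈beyond → proj₁ (proj₂ (∈-beyond⁻ p∈beyond)) refl

  -- ... and, when p is a hub, leaves a region: a step out of the remaining
  -- part of T would have to enter the star of p.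
  beyond-region : ∀ {T p} → Region T → Hub p → Region (beyond T p)
  beyond-region {T} {p} R hub = record { avoids-u = avoids ; closed = closed′ }
    where
    avoids : u ∉ beyond T p
    avoids u∈beyond = avoids-u R (proj₁ (∈-beyond⁻ u∈beyond))

    closed′ : ∀ {v w} → v ∈ beyond T p → Adj G v w → w ≢ u → w ∈ beyond T p
    closed′ {v} {w} v∈beyond v~w w≢u with ∈-beyond⁻ v∈beyond
    ... | v∈T , v≢p , p≁v = ∈-beyond⁺ (closed R v∈T v~w w≢u) w≢p p≁w
      where
      w≢p : w ≢ p
      w≢p refl = p≁v (Adj-sym G v~w)
      p≁w : ¬ Adj G p w
      p≁w p~w = v≢p (hub p~w w≢u (Adj-sym G v~w) (∈⇒≢u R v∈T))

  -- If the cop wins against a robber confined to a region T, he also wins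
  -- against one known to be at u or in T: probe u.  Answer 0 locates him;
  -- answer 1 means he was in T, and his next move cannot leave T.
  probe-u : ∀ {T} → Region T → Confined T →
            ∀ (S : Fin n → Set) → (∀ v → S v → v ≡ u ⊎ v ∈ T) → CopWins G S
  probe-u {T} R win-in-T S S⊆u∪T = probe u answer
    where
    moved-inside : ∀ w → Move G u (Answer G S u 1) w → w ∈ T
    moved-inside w (w≢u , v , (Sv , v~u) , move) with S⊆u∪T v Sv
    ... | inj₁ v≡u = ⊥-elim (Adj⇒≢ G (dist1⇒Adj G v~u) v≡u)
    ... | inj₂ v∈T = stays R v∈T move w≢u

    answer : ∀ d → Determined G (Answer G S u d) ⊎ CopWins G (Move G u (Answer G S u d))
    answer zero          = inj₁ (answer0-determined G S u)
    answer (suc zero)    = inj₂ (win-in-T _ moved-inside)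
    answer (suc (suc d)) = inj₁ λ _ _ (_ , far) _ → ⊥-elim (no-dist-to-u≥2 far)

  -- A robber at u or at a neighbour of p in G - u is caught by probing a
  -- neighbour a of p: distance 1 from a means u (no triangles), and distance
  -- 2 leaves only the other neighbour of p (no claws).
  catch-in-star : ∀ {p} → p ≢ u → ∀ (S : Fin n → Set) →
                  (∀ v → S v → v ≡ u ⊎ (v ≢ u × Adj G p v)) → CopWins G S
  catch-in-star {p} p≢u S S⊆star with any? (λ a → ¬? (a ≟ u) ×-dec (adj G p a ≟ᵇ true))
  ... | no no-leaf = at-most-one-wins G u only-u
    where
    only-u : ∀ v → S v → v ≡ u
    only-u v Sv with S⊆star v Sv
    ... | inj₁ v≡u          = v≡u
    ... | inj₂ (v≢u , p~v) = ⊥-elim (no-leaf (v , v≢u , p~v))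
  ... | yes (a , a≢u , p~a) = probe a answer
    where
    at-1 : ∀ v → Answer G S a 1 v → v ≡ u
    at-1 v (Sv , v~a) with S⊆star v Sv
    ... | inj₁ v≡u          = v≡u
    ... | inj₂ (v≢u , p~v) = ⊥-elim (triangleFree p≢u v≢u a≢u p~v (dist1⇒Adj G v~a) p~a)

    at-2 : ∀ v → Answer G S a 2 v → v ≢ u × Adj G p v
    at-2 v (Sv , v-a) with S⊆star v Sv
    ... | inj₁ refl = ⊥-elim (dist2⇒¬Adj G v-a (universal a a≢u))
    ... | inj₂ leaf = leaf

    unique-at-2 : Determined G (Answer G S a 2)
    unique-at-2 x y Sx Sy with x ≟ y
    ... | yes x≡y = x≡y
    ... | no x≢y with at-2 x Sx | at-2 y Sy
    ...   | x≢u , p~x | y≢u , p~y =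
      ⊥-elim (clawFree p≢u a≢u x≢u y≢u (≢-sym (dist2⇒≢ G (proj₂ Sx))) (≢-sym (dist2⇒≢ G (proj₂ Sy)))
                       x≢y p~a p~x p~y)

    answer : ∀ d → Determined G (Answer G S a d) ⊎ CopWins G (Move G a (Answer G S a d))
    answer zero                = inj₁ (answer0-determined G S a)
    answer (suc zero)          = inj₁ λ x y Sx Sy → trans (at-1 x Sx) (≡-sym (at-1 y Sy))
    answer (suc (suc zero))    = inj₁ unique-at-2
    answer (suc (suc (suc d))) = inj₁ λ _ _ (_ , far) _ → ⊥-elim (no-dist≥3 far)

  -- One round on a region T: probe a hub p of T.  Answer 1 leaves the robber
  -- at u or next to p; answer 2 leaves him at u or in the smaller region
  -- beyond T p, where the induction hypothesis applies.
  star-step : ∀ {T} → Region T → (∀ {T′} → T′ ⊂ T → Region T′ → Confined T′) → Confined T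
  star-step {T} R smaller S S⊆T with nonempty? T
  ... | no empty = at-most-one-wins G u λ v Sv → ⊥-elim (empty (v , S⊆T v Sv))
  ... | yes (q , q∈T) with hub-exists R q∈T
  ... | p , p∈T , hub = probe p answer
    where
    p≢u : p ≢ u
    p≢u = ∈⇒≢u R p∈T

    R′ : Region (beyond T p)
    R′ = beyond-region R hub

    near-p : ∀ w → Move G p (Answer G S p 1) w → w ≡ u ⊎ (w ≢ u × Adj G p w)
    near-p w (w≢p , v , (Sv , v~p) , inj₁ refl) =
      inj₂ (∈⇒≢u R (S⊆T v Sv) , Adj-sym G (dist1⇒Adj G v~p))
    near-p w (w≢p , v , (Sv , v~p) , inj₂ v~w) with w ≟ u
    ... | yes w≡u = inj₁ w≡u
    ... | no w≢u  = ⊥-elim (w≢p (hub (Adj-sym G (dist1⇒Adj G v~p)) (∈⇒≢u R (S⊆T v Sv)) v~w w≢u))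

    away-from-p : ∀ w → Move G p (Answer G S p 2) w → w ≡ u ⊎ w ∈ beyond T p
    away-from-p w (_ , v , (Sv , v-p) , move) with w ≟ u
    ... | yes w≡u = inj₁ w≡u
    ... | no w≢u  = inj₂ (stays R′ v∈beyond move w≢u)
      where
      v∈beyond : v ∈ beyond T p
      v∈beyond = ∈-beyond⁺ (S⊆T v Sv) (dist2⇒≢ G v-p) (λ p~v → dist2⇒¬Adj G v-p (Adj-sym G p~v))

    answer : ∀ d → Determined G (Answer G S p d) ⊎ CopWins G (Move G p (Answer G S p d))
    answer zero                = inj₁ (answer0-determined G S p)
    answer (suc zero)          = inj₂ (catch-in-star p≢u _ near-p)
    answer (suc (suc zero))    = inj₂ (probe-u R′ (smaller (beyond-⊂ p∈T) R′) _ away-from-p)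
    answer (suc (suc (suc d))) = inj₁ λ _ _ (_ , far) _ → ⊥-elim (no-dist≥3 far)

  confined-wins : ∀ T → Acc _⊂_ T → Region T → Confined T
  confined-wins T (acc smaller) R = star-step R λ T′⊂T R′ → confined-wins _ (smaller T′⊂T) R′

  locatable : Locatable G
  locatable = probe-u whole (confined-wins _ (⊂-wellFounded _) whole) _ λ v _ → at-u-or-off v
    where
    whole : Region (∁ ⁅ u ⁆)
    whole = record
      { avoids-u = x∈p⇒x∉∁p (x∈⁅x⁆ u)
      ; closed   = λ _ _ w≢u → x∉p⇒x∈∁p (x≢y⇒x∉⁅y⁆ w≢u)
      }
    at-u-or-off : ∀ v → v ≡ u ⊎ v ∈ ∁ ⁅ u ⁆
    at-u-or-off v with v ≟ u
    ... | yes v≡u = inj₁ v≡u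
    ... | no v≢u  = inj₂ (x∉p⇒x∈∁p (x≢y⇒x∉⁅y⁆ v≢u))

lemma3p9 : (n : ℕ) → 1 ≤ n → (G : Graph n) →
    maxDegree G ≡ n ∸ 1 →
    ¬ ContainsSubgraph G adjC5 →
    ¬ ContainsSubgraph G adjK4 →
    ¬ ContainsSubgraph G adjK2E3 →
    Locatable G
lemma3p9 zero () G
lemma3p9 (suc m) _ G Δ≡m noC₅ noK₄ noK₂⊕E₃ = StarStrategy.locatable G u universal
  (noK₄⇒triangleFree G u universal noK₄)
  (noC₅⇒P₄Free G u universal noC₅)
  (noK₂⊕E₃⇒clawFree G u universal noK₂⊕E₃)
  where
  u : Fin (suc m)
  u = proj₁ (full-degree-vertex G Δ≡m)
  universal : ∀ v → v ≢ u → Adj G u v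
  universal = dominating G u (proj₂ (full-degree-vertex G Δ≡m))
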